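{- Let $q\ge 2$ and let $a,b$ be integers with $(ab,q)=1$. For $x$ coprime to $q$ put $g(x)\equiv a\overline{x}+bx\pmod q$. Let $\kappa(q)$ be the number of pairs $(x,y)$ with $1\le x,y\le q$, $(xy,q)=1$, satisfying $g(x)\equiv g(y)\pmod q$. Then \[ \kappa(q)\le 2^{\omega(q)+1}\tau(q)\,q. \]
   Context: For $x$ coprime to $q$, $\overline{x}$ denotes the inverse of $x$ modulo $q$. $\tau(q)$ is the number of divisors of $q$, and $\omega(q)$ is the number of distinct prime divisors of $q$. -}

module Defs where

open import Data.Nat using (ℕ; zero; suc; _+_; _*_; _%_; _≟_; NonZero)
open import Data.Nat.Divisibility using (_∣_; _∣?_)
open import Data.Nat.Primality using (Prime; prime?)
open import Data.Nat.Coprimality using (Coprime; coprime?)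
open import Data.Integer as ℤ using (ℤ; +_)
open import Data.Integer.DivMod using (_%ℕ_)
open import Data.List using (List; []; _∷_; filter; length; map; upTo; cartesianProduct)
open import Data.Product using (_×_; _,_; proj₁; proj₂)
open import Data.Bool using (true; false)
open import Relation.Nullary using (Dec; yes; no; does)
open import Relation.Nullary.Decidable using (_×-dec_)

range1 : ℕ → List ℕ
range1 n = map suc (upTo n)

τ : ℕ → ℕ
τ q = length (filter (λ d → d ∣? q) (range1 q))

-- ω(q): number of distinct primes dividing q (all such primes are ≤ q for q ≥ 1)
ω : ℕ → ℕ
ω q = length (filter (λ p → prime? p ×-dec p ∣? q) (range1 q))

-- first element of a list satisfying a decidable predicate (0 if none)
first : {P : ℕ → Set} → ((n : ℕ) → Dec (P n)) → List ℕ → ℕ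
first P? [] = 0
first P? (x ∷ xs) with does (P? x)
... | true = x
... | false = first P? xs

-- inverse of x modulo q: the least y with 1 ≤ y ≤ q and x*y ≡ 1 (mod q)
-- (well defined and unique mod q when gcd(x,q)=1)
inv : (q : ℕ) → .{{NonZero q}} → ℕ → ℕ
inv q x = first (λ y → ((x * y) % q) ≟ (1 % q)) (range1 q)

g : (q : ℕ) → .{{NonZero q}} → ℤ → ℤ → ℕ → ℕ
g q a b x = (a ℤ.* (+ inv q x) ℤ.+ b ℤ.* (+ x)) %ℕ q

κ : (q : ℕ) → .{{NonZero q}} → ℤ → ℤ → ℕ
κ q a b = length (filter
  (λ xy → coprime? (proj₁ xy * proj₂ xy) q ×-dec (g q a b (proj₁ xy) ≟ g q a b (proj₂ xy)))
  (cartesianProduct (range1 q) (range1 q)))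

{-# OPTIONS --safe #-}
module Submission where

-- If g(x) ≡ g(y) then q ∣ (x − y)(bxy − a). Put d = (x − y, q), m = q/d, e = (d, m) and
-- ℓ = [d, m], so that eℓ = q. Then m ∣ bxy − a, hence e ∣ bx² − a, and for a fixed solution x0
-- of bz² ≡ a (mod e) we get e ∣ (x − x0)(x + x0). Since (x − x0, x + x0) divides 2x, the
-- residue of x modulo e is fixed by knowing, for each odd prime p ∣ q, whether p ∣ x − x0,
-- whether 4 ∣ x − x0, and one more bit for the top power of 2. Given x, the conditions
-- d ∣ y − x and m ∣ bx(y − y′) fix y modulo ℓ. So (x, y) is determined by d, ω(q) + 1 bits,
-- and the pair of quotients ((x − 1) div e, (y − 1) div ℓ), which ranges over fewer than
-- ℓe = q values.

open import Defs
open import Data.Bool using (Bool; true; false)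
open import Data.Empty using (⊥; ⊥-elim)
open import Data.Integer as ℤ using (ℤ; +_; ∣_∣; 1ℤ)
open import Data.Integer.DivMod using (_%ℕ_; _/ℕ_; a≡a%ℕn+[a/ℕn]*n)
import Data.Integer.Divisibility.Signed as ℤ
import Data.Integer.Properties as ℤ
open import Data.Integer.Tactic.RingSolver using (solve-∀)
open import Data.List using (List; []; _∷_; _++_; map; filter; length; upTo; cartesianProduct)
open import Data.List.Membership.Propositional using (_∈_)
open import Data.List.Membership.Propositional.Properties
  using ( ∈-++⁺ˡ; ∈-++⁺ʳ; ∈-map⁺; ∈-map⁻; ∈-upTo⁺; ∈-upTo⁻; ∈-filter⁺; ∈-filter⁻
        ; ∈-cartesianProduct⁺; ∈-cartesianProduct⁻)
open import Data.List.Properties using (length-++; length-map; length-removeAt′; length-upTo; ∷-injective)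
import Data.List.Relation.Unary.All as All
open import Data.List.Relation.Unary.All using (_∷_)
open import Data.List.Relation.Unary.AllPairs using (_∷_)
open import Data.List.Relation.Unary.Any using (here; there; _─_)
open import Data.List.Relation.Unary.Unique.Propositional using (Unique)
import Data.List.Relation.Unary.Unique.Propositional.Properties as Unique
open import Data.Nat
  using (ℕ; zero; suc; _+_; _*_; _∸_; _^_; _≤_; _<_; _%_; _/_; _<?_; _≟_; z≤n; s≤s; NonZero; ≢-nonZero; ≢-nonZero⁻¹)
open import Data.Nat.Properties
  using ( *-comm; *-assoc; *-identityˡ; +-comm; +-identityʳ; ≤-refl; <⇒≤; ≤-total; ≮⇒≥; suc-injective
        ; m+[n∸m]≡n; m<m*n; m<n+o⇒m∸n<o; +-monoʳ-<; *-monoˡ-≤; *-monoʳ-<; *-cancelˡ-<; *-cancelʳ-≡; +-cancelʳ-≡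
        ; ^-distribˡ-+-*; module ≤-Reasoning)
open import Data.Nat.DivMod
  using ( m≡m%n+[m/n]*n; m%n<n; n%n≡0; m<n⇒m%n≡m; [m+kn]%n≡m%n; %-distribˡ-+; %-distribˡ-*; %-remove-+ʳ
        ; m∣n⇒o%n%m≡o%m; m<n⇒m/n≡0; m/n≡1+[m∸n]/n; m<n*o⇒m/o<n; m*[n/m]≡n; m/n*n≡m; /-congʳ)
open import Data.Nat.Divisibility
  using ( _∣_; _∣?_; divides; ∣-trans; ∣-antisym; 0∣⇒≡0; ∣⇒≤; m∣m*n; n∣m*n; ∣m⇒∣m*n; ∣n⇒∣m*n
        ; *-cancelˡ-∣; m%n≡0⇒n∣m)
open import Data.Nat.Coprimality as Coprime
  using (Coprime; coprime?; coprime-Bézout; coprime-divisor; coprime⇒gcd≡1; coprime-/gcd; 1-coprimeTo)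
open import Data.Nat.GCD using (gcd; gcd[m,n]∣m; gcd[m,n]∣n; gcd-greatest; gcd[m,n]≢0; module Bézout)
open import Data.Nat.LCM using (lcm; lcm-least; gcd*lcm)
open import Data.Nat.Primality using (Prime; prime?; prime[2]; ¬prime[1]; prime⇒nonZero; prime⇒irreducible)
open import Data.Nat.Primality.Factorisation using (factorise)
open import Data.Nat.Induction using (<-rec)
open import Data.Nat.ListAction using (product)
import Data.Nat.Tactic.RingSolver as ℕ
open import Data.Product using (Σ; _×_; _,_; proj₁; proj₂)
open import Data.Sum using (inj₁; inj₂)
open import Function using (_∘_)
open import Relation.Binary.PropositionalEquality
open import Relation.Nullary using (Dec; yes; no; ¬_; does)
open import Relation.Nullary.Decidable using (_×-dec_)

-- Counting by an injection

length-cartesianProduct : ∀ {A B : Set} (xs : List A) (ys : List B) →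
  length (cartesianProduct xs ys) ≡ length xs * length ys
length-cartesianProduct []       ys = refl
length-cartesianProduct (x ∷ xs) ys = begin
  length (map (x ,_) ys ++ cartesianProduct xs ys)
    ≡⟨ length-++ (map (x ,_) ys) ⟩
  length (map (x ,_) ys) + length (cartesianProduct xs ys)
    ≡⟨ cong₂ _+_ (length-map (x ,_) ys) (length-cartesianProduct xs ys) ⟩
  length ys + length xs * length ys
    ∎
  where open ≡-Reasoning

bitStrings : ℕ → List (List Bool)
bitStrings zero    = [] ∷ []
bitStrings (suc n) = map (true ∷_) (bitStrings n) ++ map (false ∷_) (bitStrings n)

length-bitStrings : ∀ n → length (bitStrings n) ≡ 2 ^ n
length-bitStrings zero    = refl
length-bitStrings (suc n) = begin
  length (map (true ∷_) bs ++ map (false ∷_) bs)          ≡⟨ length-++ (map (true ∷_) bs) ⟩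
  length (map (true ∷_) bs) + length (map (false ∷_) bs)  ≡⟨ cong₂ _+_ (length-map (true ∷_) bs) (length-map (false ∷_) bs) ⟩
  length bs + length bs                                   ≡⟨ cong (λ k → k + k) (length-bitStrings n) ⟩
  2 ^ n + 2 ^ n                                           ≡⟨ cong (λ k → 2 ^ n + k) (+-identityʳ (2 ^ n)) ⟨
  2 ^ suc n                                               ∎
  where
  open ≡-Reasoning
  bs = bitStrings n

∈-bitStrings : ∀ (bs : List Bool) → bs ∈ bitStrings (length bs)
∈-bitStrings []           = here refl
∈-bitStrings (true ∷ bs)  = ∈-++⁺ˡ (∈-map⁺ (true ∷_) (∈-bitStrings bs))
∈-bitStrings (false ∷ bs) =
  ∈-++⁺ʳ (map (true ∷_) (bitStrings (length bs))) (∈-map⁺ (false ∷_) (∈-bitStrings bs))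

∈-─⁺ : ∀ {A : Set} {x z : A} {ys : List A} (x∈ys : x ∈ ys) → z ∈ ys → z ≢ x → z ∈ (ys ─ x∈ys)
∈-─⁺ (here refl)  (here refl)  z≢x = ⊥-elim (z≢x refl)
∈-─⁺ (here refl)  (there z∈ys) z≢x = z∈ys
∈-─⁺ (there x∈ys) (here z≡y)   z≢x = here z≡y
∈-─⁺ (there x∈ys) (there z∈ys) z≢x = there (∈-─⁺ x∈ys z∈ys z≢x)

length-≤-injection : ∀ {A B : Set} (f : A → B) (xs : List A) (ys : List B) → Unique xs →
  (∀ {x y} → x ∈ xs → y ∈ xs → f x ≡ f y → x ≡ y) →
  (∀ {x} → x ∈ xs → f x ∈ ys) →
  length xs ≤ length ys
length-≤-injection f []       ys _            _   _   = z≤n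
length-≤-injection f (x ∷ xs) ys (x∉xs ∷ uxs) inj ∈ys =
  subst (suc (length xs) ≤_) (sym (length-removeAt′ ys _))
    (s≤s (length-≤-injection f xs (ys ─ fx∈ys) uxs
      (λ p q → inj (there p) (there q))
      (λ z∈xs → ∈-─⁺ fx∈ys (∈ys (there z∈xs))
        (λ fz≡fx → All.lookup x∉xs z∈xs (inj (here refl) (there z∈xs) (sym fz≡fx))))))
  where fx∈ys = ∈ys (here refl)

first-satisfies : {P : ℕ → Set} (P? : (n : ℕ) → Dec (P n)) (xs : List ℕ) {x : ℕ} →
  x ∈ xs → P x → P (first P? xs)
first-satisfies P? (y ∷ xs) x∈ px with P? y
... | yes py = py
first-satisfies P? (y ∷ xs) (here refl) px | no ¬py = ⊥-elim (¬py px)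
first-satisfies P? (y ∷ xs) (there x∈) px | no ¬py = first-satisfies P? xs x∈ px

∈-range1⁺ : ∀ {n x} .{{_ : NonZero x}} → x ≤ n → x ∈ range1 n
∈-range1⁺ {x = suc _} x≤n = ∈-map⁺ suc (∈-upTo⁺ x≤n)

∈-range1⁻ : ∀ {n x} → x ∈ range1 n → Σ ℕ λ u → x ≡ suc u × u < n
∈-range1⁻ x∈ with ∈-map⁻ suc x∈
... | u , u∈ , refl = u , refl , ∈-upTo⁻ u∈

map-≡⇒≡ : ∀ {A B : Set} (f g : A → B) {xs : List A} → map f xs ≡ map g xs → ∀ {x} → x ∈ xs → f x ≡ g x
map-≡⇒≡ f g {_ ∷ _}  eq (here refl) = proj₁ (∷-injective eq)
map-≡⇒≡ f g {_ ∷ xs} eq (there x∈)  = map-≡⇒≡ f g (proj₂ (∷-injective eq)) x∈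

does-≡⇒ : ∀ {A B : Set} (a? : Dec A) (b? : Dec B) → does a? ≡ does b? → A → B
does-≡⇒ (yes _) (yes b) _  _ = b
does-≡⇒ (no ¬a) _       _  a = ⊥-elim (¬a a)
does-≡⇒ (yes _) (no _)  () _

dist : ℕ → ℕ → ℕ
dist x y = ∣ + x ℤ.- + y ∣

%ℕ-≡⇒∣- : ∀ k .{{_ : NonZero k}} (t u : ℤ) → t %ℕ k ≡ u %ℕ k → + k ℤ.∣ t ℤ.- u
%ℕ-≡⇒∣- k t u eq = ℤ.divides (t /ℕ k ℤ.- u /ℕ k) (begin
  t ℤ.- u
    ≡⟨ cong₂ ℤ._-_ (a≡a%ℕn+[a/ℕn]*n t k) (a≡a%ℕn+[a/ℕn]*n u k) ⟩
  (+ (t %ℕ k) ℤ.+ t /ℕ k ℤ.* + k) ℤ.- (+ (u %ℕ k) ℤ.+ u /ℕ k ℤ.* + k)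
    ≡⟨ cong (λ r → (+ r ℤ.+ t /ℕ k ℤ.* + k) ℤ.- (+ (u %ℕ k) ℤ.+ u /ℕ k ℤ.* + k)) eq ⟩
  (+ (u %ℕ k) ℤ.+ t /ℕ k ℤ.* + k) ℤ.- (+ (u %ℕ k) ℤ.+ u /ℕ k ℤ.* + k)
    ≡⟨ cancel (+ (u %ℕ k)) (t /ℕ k) (u /ℕ k) (+ k) ⟩
  (t /ℕ k ℤ.- u /ℕ k) ℤ.* + k
    ∎)
  where
  open ≡-Reasoning
  cancel : ∀ r i j k → (r ℤ.+ i ℤ.* k) ℤ.- (r ℤ.+ j ℤ.* k) ≡ (i ℤ.- j) ℤ.* k
  cancel = solve-∀

%-≡⇒∣dist : ∀ k .{{_ : NonZero k}} {x y} → x % k ≡ y % k → k ∣ dist x y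
%-≡⇒∣dist k {x} {y} eq = ℤ.∣⇒∣ᵤ (%ℕ-≡⇒∣- k (+ x) (+ y) eq)

dist-comm : ∀ x y → dist x y ≡ dist y x
dist-comm x y = trans (cong ∣_∣ (ℤ.[+m]-[+n]≡m⊖n x y))
  (trans (ℤ.∣m⊖n∣≡∣n⊖m∣ x y) (cong ∣_∣ (sym (ℤ.[+m]-[+n]≡m⊖n y x))))

dist-≤ : ∀ {x y} → y ≤ x → dist x y ≡ x ∸ y
dist-≤ {x} {y} y≤x = trans (cong ∣_∣ (ℤ.[+m]-[+n]≡m⊖n x y)) (cong ∣_∣ (ℤ.⊖-≥ y≤x))

dist-suc : ∀ x y → dist (suc x) (suc y) ≡ dist x y
dist-suc x y = cong ∣_∣ (trans (ℤ.[+m]-[+n]≡m⊖n (suc x) (suc y))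
  (trans (ℤ.[1+m]⊖[1+n]≡m⊖n x y) (sym (ℤ.[+m]-[+n]≡m⊖n x y))))

∣dist⇒%-≡ : ∀ k .{{_ : NonZero k}} {x y} → k ∣ dist x y → x % k ≡ y % k
∣dist⇒%-≡ k {x} {y} k∣ with ≤-total y x
... | inj₁ y≤x = trans (cong (_% k) (sym (m+[n∸m]≡n y≤x)))
                   (%-remove-+ʳ y (subst (k ∣_) (dist-≤ y≤x) k∣))
... | inj₂ x≤y = sym (trans (cong (_% k) (sym (m+[n∸m]≡n x≤y)))
                   (%-remove-+ʳ x (subst (k ∣_) (trans (dist-comm x y) (dist-≤ x≤y)) k∣)))

%-≡∧/-≡⇒≡ : ∀ k .{{_ : NonZero k}} {x y} → x % k ≡ y % k → x / k ≡ y / k → x ≡ y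
%-≡∧/-≡⇒≡ k {x} {y} %≡ /≡ = begin
  x                  ≡⟨ m≡m%n+[m/n]*n x k ⟩
  x % k + x / k * k  ≡⟨ cong₂ (λ r s → r + s * k) %≡ /≡ ⟩
  y % k + y / k * k  ≡⟨ m≡m%n+[m/n]*n y k ⟨
  y                  ∎
  where open ≡-Reasoning

∣dist∧/-≡⇒≡ : ∀ k .{{_ : NonZero k}} {x y} → k ∣ dist x y → x / k ≡ y / k → x ≡ y
∣dist∧/-≡⇒≡ k k∣ /≡ = %-≡∧/-≡⇒≡ k (∣dist⇒%-≡ k k∣) /≡

∣dist-trans : ∀ {k} x y z → k ∣ dist x z → k ∣ dist y z → k ∣ dist x y
∣dist-trans {k} x y z k∣xz k∣yz = ℤ.∣⇒∣ᵤ (subst (+ k ℤ.∣_) (cancel (+ x) (+ y) (+ z))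
  (ℤ.∣m∣n⇒∣m-n (ℤ.∣ᵤ⇒∣ {i = + x ℤ.- + z} k∣xz) (ℤ.∣ᵤ⇒∣ {i = + y ℤ.- + z} k∣yz)))
  where
  cancel : ∀ x y z → (x ℤ.- z) ℤ.- (y ℤ.- z) ≡ x ℤ.- y
  cancel = solve-∀

∣+⇒∣dist : ∀ {k} x y z → k ∣ x + z → k ∣ y + z → k ∣ dist x y
∣+⇒∣dist {k} x y z k∣xz k∣yz = ℤ.∣⇒∣ᵤ (subst (+ k ℤ.∣_) (cancel (+ x) (+ y) (+ z))
  (ℤ.∣m∣n⇒∣m-n (ℤ.∣ᵤ⇒∣ {i = + x ℤ.+ + z} k∣xz) (ℤ.∣ᵤ⇒∣ {i = + y ℤ.+ + z} k∣yz)))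
  where
  cancel : ∀ x y z → (x ℤ.+ z) ℤ.- (y ℤ.+ z) ≡ x ℤ.- y
  cancel = solve-∀

∣dist∧∣+⇒∣2* : ∀ {k} x z → k ∣ dist x z → k ∣ x + z → k ∣ 2 * x
∣dist∧∣+⇒∣2* {k} x z k∣- k∣+ =
  ℤ.∣⇒∣ᵤ (subst (+ k ℤ.∣_) (trans (sum (+ x) (+ z)) (sym (ℤ.pos-* 2 x)))
  (ℤ.∣m∣n⇒∣m+n (ℤ.∣ᵤ⇒∣ {i = + x ℤ.- + z} k∣-) (ℤ.∣ᵤ⇒∣ {i = + x ℤ.+ + z} k∣+)))
  where
  sum : ∀ x z → (x ℤ.- z) ℤ.+ (x ℤ.+ z) ≡ + 2 ℤ.* x
  sum = solve-∀

range1-complete : ∀ q .{{_ : NonZero q}} z → Σ ℕ λ y → y ∈ range1 q × y % q ≡ z % q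
range1-complete q@(suc p) z with z % q in eq
... | zero  = q , ∈-range1⁺ ≤-refl , n%n≡0 q
... | suc r = suc r , ∈-range1⁺ (<⇒≤ r+1<q) , m<n⇒m%n≡m r+1<q
  where
  r+1<q : suc r < q
  r+1<q = subst (_< q) eq (m%n<n z q)

*-cong-% : ∀ x {y z} q .{{_ : NonZero q}} → y % q ≡ z % q → (x * y) % q ≡ (x * z) % q
*-cong-% x {y} {z} q eq = begin
  (x * y) % q              ≡⟨ %-distribˡ-* x y q ⟩
  (x % q * (y % q)) % q    ≡⟨ cong (λ r → (x % q * r) % q) eq ⟩
  (x % q * (z % q)) % q    ≡⟨ %-distribˡ-* x z q ⟨
  (x * z) % q              ∎
  where open ≡-Reasoning

coprime⇒∃inverse : ∀ {x} q .{{_ : NonZero q}} → Coprime x q → Σ ℕ λ z → (x * z) % q ≡ 1 % q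
coprime⇒∃inverse {x} q@(suc p) x⊥q with coprime-Bézout x⊥q
... | Bézout.+- u v 1+vq≡ux = u , (begin
  (x * u) % q      ≡⟨ cong (_% q) (trans (*-comm x u) (sym 1+vq≡ux)) ⟩
  (1 + v * q) % q  ≡⟨ [m+kn]%n≡m%n 1 v q ⟩
  1 % q            ∎)
  where open ≡-Reasoning
-- Here x u ≡ −1, so u (q − 1) is an inverse.
... | Bézout.-+ u v 1+ux≡vq = u * p , (begin
  (x * (u * p)) % q              ≡⟨ [m+kn]%n≡m%n (x * (u * p)) v q ⟨
  (x * (u * p) + v * q) % q      ≡⟨ cong (λ w → (x * (u * p) + w) % q) (sym 1+ux≡vq) ⟩
  (x * (u * p) + (1 + u * x)) % q ≡⟨ cong (_% q) (expand x u p) ⟩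
  (1 + (x * u) * q) % q          ≡⟨ [m+kn]%n≡m%n 1 (x * u) q ⟩
  1 % q                          ∎)
  where
  open ≡-Reasoning
  expand : ∀ x u p → x * (u * p) + (1 + u * x) ≡ 1 + (x * u) * suc p
  expand = ℕ.solve-∀

inv-inverse : ∀ q .{{_ : NonZero q}} {x} → Coprime x q → + q ℤ.∣ + x ℤ.* + inv q x ℤ.- 1ℤ
inv-inverse q {x} x⊥q with coprime⇒∃inverse q x⊥q
... | z , xz≡1 with range1-complete q z
... | y , y∈ , y≡z =
  subst (λ t → + q ℤ.∣ t ℤ.- 1ℤ) (ℤ.pos-* x (inv q x))
    (%ℕ-≡⇒∣- q (+ (x * inv q x)) 1ℤ
      (first-satisfies (λ y → ((x * y) % q) ≟ (1 % q)) (range1 q) y∈ (trans (*-cong-% x q y≡z) xz≡1)))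

-- x y (g(x) − g(y)) ≡ (x − y)(bxy − a), using x x̄ ≡ y ȳ ≡ 1.
g-≡⇒∣ : ∀ q .{{_ : NonZero q}} (a b : ℤ) {x y} → Coprime x q → Coprime y q →
  g q a b x ≡ g q a b y → + q ℤ.∣ (+ x ℤ.- + y) ℤ.* (b ℤ.* + x ℤ.* + y ℤ.- a)
g-≡⇒∣ q a b {x} {y} x⊥q y⊥q gx≡gy =
  subst (+ q ℤ.∣_) (identity (+ x) (+ y) (+ inv q x) (+ inv q y) a b)
    (ℤ.∣m∣n⇒∣m+n (ℤ.∣m∣n⇒∣m-n (ℤ.∣n⇒∣m*n (+ x ℤ.* + y) q∣gx-gy)
                              (ℤ.∣n⇒∣m*n (a ℤ.* + y) (inv-inverse q x⊥q)))
                 (ℤ.∣n⇒∣m*n (a ℤ.* + x) (inv-inverse q y⊥q)))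
  where
  q∣gx-gy = %ℕ-≡⇒∣- q (a ℤ.* + inv q x ℤ.+ b ℤ.* + x) (a ℤ.* + inv q y ℤ.+ b ℤ.* + y) gx≡gy
  identity : ∀ x y x̄ ȳ a b →
    (x ℤ.* y) ℤ.* ((a ℤ.* x̄ ℤ.+ b ℤ.* x) ℤ.- (a ℤ.* ȳ ℤ.+ b ℤ.* y))
      ℤ.- (a ℤ.* y) ℤ.* (x ℤ.* x̄ ℤ.- 1ℤ) ℤ.+ (a ℤ.* x) ℤ.* (y ℤ.* ȳ ℤ.- 1ℤ)
      ≡ (x ℤ.- y) ℤ.* (b ℤ.* x ℤ.* y ℤ.- a)
  identity = solve-∀

gcd-nonZeroʳ : ∀ m n .{{_ : NonZero n}} → NonZero (gcd m n)
gcd-nonZeroʳ m n = ≢-nonZero (gcd[m,n]≢0 m n (inj₂ (≢-nonZero⁻¹ n)))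

∣-nonZero : ∀ {m n} .{{_ : NonZero n}} → m ∣ n → NonZero m
∣-nonZero {n = n} m∣n = ≢-nonZero λ { refl → ≢-nonZero⁻¹ n (0∣⇒≡0 m∣n) }

coprime-*ˡ : ∀ {m m′ n} → Coprime m n → Coprime m′ n → Coprime (m * m′) n
coprime-*ˡ {m} m⊥n m′⊥n {i} (i∣mm′ , i∣n) = m′⊥n (coprime-divisor i⊥m i∣mm′ , i∣n)
  where
  i⊥m : Coprime i m
  i⊥m (j∣i , j∣m) = m⊥n (j∣m , ∣-trans j∣i i∣n)

coprime-^ˡ : ∀ {m n} → Coprime m n → ∀ j → Coprime (m ^ j) n
coprime-^ˡ {n = n} m⊥n zero    = 1-coprimeTo n
coprime-^ˡ         m⊥n (suc j) = coprime-*ˡ m⊥n (coprime-^ˡ m⊥n j)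

coprime⇒*∣ : ∀ {m n k} → Coprime m n → m ∣ k → n ∣ k → m * n ∣ k
coprime⇒*∣ {m} {n} {k} m⊥n m∣k n∣k = subst (_∣ k) lcm≡ (lcm-least m∣k n∣k)
  where
  lcm≡ : lcm m n ≡ m * n
  lcm≡ = trans (sym (*-identityˡ (lcm m n)))
           (trans (cong (_* lcm m n) (sym (coprime⇒gcd≡1 m⊥n))) (gcd*lcm m n))

prime∤⇒coprime : ∀ {p n} → Prime p → ¬ p ∣ n → Coprime p n
prime∤⇒coprime p-prime p∤n (i∣p , i∣n) with prime⇒irreducible p-prime i∣p
... | inj₁ i≡1  = i≡1
... | inj₂ refl = ⊥-elim (p∤n i∣n)

∃prime∣ : ∀ n → 2 ≤ n → Σ ℕ λ p → Prime p × p ∣ n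
∃prime∣ n@(suc _) (s≤s 1≤n) with factorise n
... | record { factors = [] ; isFactorisation = refl } with () ← 1≤n
... | record { factors = p ∷ ps ; isFactorisation = eq ; factorsPrime = p-prime ∷ _ } =
  p , p-prime , subst (p ∣_) (sym eq) (m∣m*n (product ps))

∄prime∣⇒coprime : ∀ {m n} → (∀ p → Prime p → p ∣ m → p ∣ n → ⊥) → Coprime m n
∄prime∣⇒coprime {m} {n} no-prime {i} (i∣m , i∣n) with i
... | zero = ⊥-elim (no-prime 2 prime[2] (subst (2 ∣_) (sym (0∣⇒≡0 i∣m)) (divides 0 refl))
                                           (subst (2 ∣_) (sym (0∣⇒≡0 i∣n)) (divides 0 refl)))
... | suc zero = refl
... | i@(suc (suc _)) with ∃prime∣ i (s≤s (s≤s z≤n))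
... | p , p-prime , p∣i = ⊥-elim (no-prime p p-prime (∣-trans p∣i i∣m) (∣-trans p∣i i∣n))

2-adic : ∀ n .{{_ : NonZero n}} → Σ ℕ λ k → Σ ℕ λ o → n ≡ 2 ^ k * o × ¬ 2 ∣ o
2-adic = <-rec P step
  where
  P : ℕ → Set
  P n = .{{NonZero n}} → Σ ℕ λ k → Σ ℕ λ o → n ≡ 2 ^ k * o × ¬ 2 ∣ o
  step : ∀ n → (∀ {m} → m < n → P m) → P n
  step n rec with 2 ∣? n
  ... | no 2∤n = 0 , n , sym (+-identityʳ n) , 2∤n
  ... | yes (divides zero    refl) = ⊥-elim (≢-nonZero⁻¹ 0 refl)
  ... | yes (divides m@(suc _) refl) with rec {m} (m<m*n m 2 (s≤s (s≤s z≤n)))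
  ... | k , o , m≡2^k*o , 2∤o = suc k , o , (begin
    m * 2            ≡⟨ cong (_* 2) m≡2^k*o ⟩
    2 ^ k * o * 2    ≡⟨ *-comm (2 ^ k * o) 2 ⟩
    2 * (2 ^ k * o)  ≡⟨ *-assoc 2 (2 ^ k) o ⟨
    2 ^ suc k * o    ∎) , 2∤o
    where open ≡-Reasoning

∤2⇒%2≡1 : ∀ {n} → ¬ 2 ∣ n → n % 2 ≡ 1
∤2⇒%2≡1 {n} 2∤n with n % 2 in eq | m%n<n n 2
... | zero        | _ = ⊥-elim (2∤n (m%n≡0⇒n∣m n 2 eq))
... | suc zero    | _ = refl
... | suc (suc _) | s≤s (s≤s ())

coprime-∣ʳ : ∀ {m n k} → Coprime m n → k ∣ n → Coprime m k
coprime-∣ʳ m⊥n k∣n (i∣m , i∣k) = m⊥n (i∣m , ∣-trans i∣k k∣n)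

coprime∧∣⇒∤ : ∀ {m n} → Coprime m n → 2 ∣ n → ¬ 2 ∣ m
coprime∧∣⇒∤ m⊥n 2∣n 2∣m with m⊥n (2∣m , 2∣n)
... | ()

infixl 7 _/₀_ _%₀_

-- Division and remainder with junk value 0 at divisor 0, so that the encoding needs no
-- NonZero side conditions; they are only ever used at nonzero divisors.
_/₀_ : ℕ → ℕ → ℕ
n /₀ zero  = 0
n /₀ suc k = n / suc k

_%₀_ : ℕ → ℕ → ℕ
n %₀ zero  = 0
n %₀ suc k = n % suc k

/₀≡/ : ∀ n k .{{_ : NonZero k}} → n /₀ k ≡ n / k
/₀≡/ n (suc k) = refl

/₀-<-range1 : ∀ {k n x} .{{_ : NonZero n}} → x ∈ range1 (k * n) → (x ∸ 1) /₀ n < k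
/₀-<-range1 {k} {n} x∈ with ∈-range1⁻ x∈
... | u , refl , u<kn = subst (_< k) (sym (/₀≡/ u n)) (m<n*o⇒m/o<n u<kn)

∣dist∧/₀-≡⇒≡ : ∀ {n} k .{{_ : NonZero k}} {x x′} → x ∈ range1 n → x′ ∈ range1 n →
  k ∣ dist x x′ → (x ∸ 1) /₀ k ≡ (x′ ∸ 1) /₀ k → x ≡ x′
∣dist∧/₀-≡⇒≡ k x∈ x′∈ k∣ /≡ with ∈-range1⁻ x∈ | ∈-range1⁻ x′∈
... | u , refl , _ | u′ , refl , _ = cong suc (∣dist∧/-≡⇒≡ k (subst (k ∣_) (dist-suc u u′) k∣)
  (trans (sym (/₀≡/ u k)) (trans /≡ (/₀≡/ u′ k))))

j*n+k<m*n : ∀ {j k m n} → j < m → k < n → j * n + k < m * n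
j*n+k<m*n {j} {k} {m} {n} j<m k<n = begin-strict
  j * n + k  <⟨ +-monoʳ-< (j * n) k<n ⟩
  j * n + n  ≡⟨ +-comm (j * n) n ⟩
  suc j * n  ≤⟨ *-monoˡ-≤ n j<m ⟩
  m * n      ∎
  where open ≤-Reasoning

*+-injective : ∀ n .{{_ : NonZero n}} {j j′ k k′} → k < n → k′ < n →
  j * n + k ≡ j′ * n + k′ → j ≡ j′ × k ≡ k′
*+-injective n {j} {j′} {k} {k′} k<n k′<n eq =
  *-cancelʳ-≡ j j′ n (+-cancelʳ-≡ k (j * n) (j′ * n) (trans eq (cong (λ l → j′ * n + l) (sym k≡k′)))) , k≡k′
  where
  remainder : ∀ i l → l < n → (i * n + l) % n ≡ l
  remainder i l l<n = trans (cong (_% n) (+-comm (i * n) l)) (trans ([m+kn]%n≡m%n l i n) (m<n⇒m%n≡m l<n))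
  k≡k′ : k ≡ k′
  k≡k′ = trans (sym (remainder j k k<n)) (trans (cong (_% n) eq) (remainder j′ k′ k′<n))

h≤m<2h⇒m/h≡1 : ∀ {m h} .{{_ : NonZero h}} → h ≤ m → m < 2 * h → m / h ≡ 1
h≤m<2h⇒m/h≡1 {m} {h} h≤m m<2h = trans (m/n≡1+[m∸n]/n h≤m)
  (cong suc (m<n⇒m/n≡0 (m<n+o⇒m∸n<o m h (subst (m <_) (cong (λ k → h + k) (+-identityʳ h)) m<2h))))

-- Solutions of x² ≡ x0² modulo e

n∣m*o⇒n/gcd[m,n]∣o : ∀ m {n o} .{{_ : NonZero (gcd m n)}} → n ∣ m * o → n / gcd m n ∣ o
n∣m*o⇒n/gcd[m,n]∣o m {n} {o} n∣mo =
  coprime-divisor (Coprime.sym (coprime-/gcd m n)) (*-cancelˡ-∣ (gcd m n) (subst₂ _∣_ n≡ mo≡ n∣mo))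
  where
  n≡ : n ≡ gcd m n * (n / gcd m n)
  n≡ = sym (m*[n/m]≡n (gcd[m,n]∣n m n))
  mo≡ : m * o ≡ gcd m n * (m / gcd m n * o)
  mo≡ = trans (cong (_* o) (sym (m*[n/m]≡n (gcd[m,n]∣m m n)))) (*-assoc (gcd m n) (m / gcd m n) o)

gcd-cofactor-coprime : ∀ {s t o} .{{_ : NonZero (gcd s o)}} → Coprime (gcd s t) o → o ∣ s * t →
  Coprime (gcd s o) (o / gcd s o)
gcd-cofactor-coprime {s} {t} {o} st⊥o o∣st (c∣u , c∣w) =
  st⊥o (gcd-greatest (∣-trans c∣u (gcd[m,n]∣m s o)) (∣-trans c∣w (n∣m*o⇒n/gcd[m,n]∣o s o∣st)) ,
        ∣-trans c∣u (gcd[m,n]∣n s o))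

primes∣⇒gcd∣gcd : ∀ {s s′ o} .{{_ : NonZero (gcd s′ o)}} →
  (∀ p → Prime p → p ∣ o → p ∣ s → p ∣ s′) → Coprime (gcd s′ o) (o / gcd s′ o) → gcd s o ∣ gcd s′ o
primes∣⇒gcd∣gcd {s} {s′} {o} primes u′⊥w′ =
  coprime-divisor u⊥w′ (subst (gcd s o ∣_) (sym (m/n*n≡m (gcd[m,n]∣n s′ o))) (gcd[m,n]∣n s o))
  where
  u⊥w′ : Coprime (gcd s o) (o / gcd s′ o)
  u⊥w′ = ∄prime∣⇒coprime λ p p-prime p∣u p∣w′ →
    let p∣o = ∣-trans p∣u (gcd[m,n]∣n s o)
        p∣s′ = primes p p-prime p∣o (∣-trans p∣u (gcd[m,n]∣m s o))
    in ¬prime[1] (subst Prime (u′⊥w′ (gcd-greatest p∣s′ p∣o , p∣w′)) p-prime)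

dist-sum-coprime : ∀ {x x0 o} → ¬ 2 ∣ o → Coprime x o → Coprime (gcd (dist x x0) (x + x0)) o
dist-sum-coprime {x} {x0} 2∤o x⊥o {c} (c∣g , c∣o) = x⊥o (coprime-divisor c⊥2 c∣2x , c∣o)
  where
  c∣2x : c ∣ 2 * x
  c∣2x = ∣dist∧∣+⇒∣2* x x0 (∣-trans c∣g (gcd[m,n]∣m (dist x x0) (x + x0)))
                           (∣-trans c∣g (gcd[m,n]∣n (dist x x0) (x + x0)))
  c⊥2 : Coprime c 2
  c⊥2 = Coprime.sym (prime∤⇒coprime prime[2] (λ 2∣c → 2∤o (∣-trans 2∣c c∣o)))

-- u = (x − x0, o) is fixed by which primes of o divide x − x0, and o/u divides x + x0;
-- hence both u and o/u divide x − x′.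
odd-root-determined : ∀ {o} .{{_ : NonZero o}} {x x′ x0} → ¬ 2 ∣ o → Coprime x o → Coprime x′ o →
  o ∣ dist x x0 * (x + x0) → o ∣ dist x′ x0 * (x′ + x0) →
  (∀ p → Prime p → p ∣ o → p ∣ dist x x0 → p ∣ dist x′ x0) →
  (∀ p → Prime p → p ∣ o → p ∣ dist x′ x0 → p ∣ dist x x0) →
  o ∣ dist x x′
odd-root-determined {o} {x} {x′} {x0} 2∤o x⊥o x′⊥o o∣st o∣s′t′ s⇒s′ s′⇒s =
  subst (_∣ dist x x′) (m*[n/m]≡n (gcd[m,n]∣n s o)) (coprime⇒*∣ u⊥w u∣x-x′ w∣x-x′)
  where
  s = dist x x0
  s′ = dist x′ x0
  instance
    _ = gcd-nonZeroʳ s o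
    _ = gcd-nonZeroʳ s′ o
  u⊥w = gcd-cofactor-coprime {s} {x + x0} (dist-sum-coprime {x} {x0} 2∤o x⊥o) o∣st
  u′⊥w′ = gcd-cofactor-coprime {s′} {x′ + x0} (dist-sum-coprime {x′} {x0} 2∤o x′⊥o) o∣s′t′
  u≡u′ : gcd s o ≡ gcd s′ o
  u≡u′ = ∣-antisym (primes∣⇒gcd∣gcd {s} {s′} s⇒s′ u′⊥w′) (primes∣⇒gcd∣gcd {s′} {s} s′⇒s u⊥w)
  u∣x-x′ : gcd s o ∣ dist x x′
  u∣x-x′ = ∣dist-trans x x′ x0 (gcd[m,n]∣m s o) (subst (_∣ s′) (sym u≡u′) (gcd[m,n]∣m s′ o))
  w∣x-x′ : o / gcd s o ∣ dist x x′
  w∣x-x′ = ∣+⇒∣dist x x′ x0 (n∣m*o⇒n/gcd[m,n]∣o s o∣st)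
    (subst (_∣ x′ + x0) (/-congʳ (sym u≡u′)) (n∣m*o⇒n/gcd[m,n]∣o s′ o∣s′t′))

2^[1+j]∣m*2n⇒2^j∣m : ∀ j {m n} → ¬ 2 ∣ n → 2 ^ suc j ∣ m * (2 * n) → 2 ^ j ∣ m
2^[1+j]∣m*2n⇒2^j∣m j {m} {n} 2∤n 2^[1+j]∣m2n =
  coprime-divisor (coprime-^ˡ (prime∤⇒coprime prime[2] 2∤n) j)
    (*-cancelˡ-∣ 2 (subst (2 ^ suc j ∣_) (rearrange m n) 2^[1+j]∣m2n))
  where
  rearrange : ∀ m n → m * (2 * n) ≡ 2 * (n * m)
  rearrange = ℕ.solve-∀

2∣n⇒4∣n*2 : ∀ {n} → 2 ∣ n → 4 ∣ n * 2
2∣n⇒4∣n*2 (divides k refl) = divides k (*-assoc k 2 2)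

module _ {x x0 : ℕ} (2∤x : ¬ 2 ∣ x) (2∤x0 : ¬ 2 ∣ x0) where

  2∣dist : 2 ∣ dist x x0
  2∣dist = %-≡⇒∣dist 2 {x} {x0} (trans (∤2⇒%2≡1 2∤x) (sym (∤2⇒%2≡1 2∤x0)))

  2∣sum : 2 ∣ x + x0
  2∣sum = m%n≡0⇒n∣m (x + x0) 2
    (trans (%-distribˡ-+ x x0 2) (cong₂ (λ r r0 → (r + r0) % 2) (∤2⇒%2≡1 2∤x) (∤2⇒%2≡1 2∤x0)))

  -- Since (x − x0) + (x + x0) = 2x with x odd, exactly one of x − x0, x + x0 is 2 mod 4.
  root-mod-2^[1+j] : ∀ j → 2 ^ suc j ∣ dist x x0 * (x + x0) →
    (4 ∣ dist x x0 → 2 ^ j ∣ dist x x0) × (¬ 4 ∣ dist x x0 → 2 ^ j ∣ x + x0)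
  root-mod-2^[1+j] j 2^[1+j]∣st = dist-case , sum-case
    where
    dist-case : 4 ∣ dist x x0 → 2 ^ j ∣ dist x x0
    dist-case 4∣s with 2∣sum
    ... | divides t eq = 2^[1+j]∣m*2n⇒2^j∣m j 2∤t
            (subst (λ u → 2 ^ suc j ∣ dist x x0 * u) (trans eq (*-comm t 2)) 2^[1+j]∣st)
      where
      2∤t : ¬ 2 ∣ t
      2∤t 2∣t = 2∤x (*-cancelˡ-∣ 2
        (∣dist∧∣+⇒∣2* x x0 4∣s (subst (4 ∣_) (sym eq) (2∣n⇒4∣n*2 {t} 2∣t))))
    sum-case : ¬ 4 ∣ dist x x0 → 2 ^ j ∣ x + x0
    sum-case 4∤s with 2∣dist
    ... | divides s eq = 2^[1+j]∣m*2n⇒2^j∣m j (λ 2∣s → 4∤s (subst (4 ∣_) (sym eq) (2∣n⇒4∣n*2 {s} 2∣s)))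
            (subst (2 ^ suc j ∣_) (trans (*-comm (dist x x0) (x + x0)) (cong ((x + x0) *_) (trans eq (*-comm s 2))))
              2^[1+j]∣st)

2-power-root-determined : ∀ j {x x′ x0} → ¬ 2 ∣ x → ¬ 2 ∣ x′ → ¬ 2 ∣ x0 →
  2 ^ suc j ∣ dist x x0 * (x + x0) → 2 ^ suc j ∣ dist x′ x0 * (x′ + x0) →
  (4 ∣ dist x x0 → 4 ∣ dist x′ x0) → (4 ∣ dist x′ x0 → 4 ∣ dist x x0) →
  2 ^ j ∣ dist x x′
2-power-root-determined j {x} {x′} {x0} 2∤x 2∤x′ 2∤x0 x-root x′-root s⇒s′ s′⇒s with 4 ∣? dist x x0
... | yes 4∣s = ∣dist-trans x x′ x0 (proj₁ (root-mod-2^[1+j] 2∤x 2∤x0 j x-root) 4∣s)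
                                     (proj₁ (root-mod-2^[1+j] 2∤x′ 2∤x0 j x′-root) (s⇒s′ 4∣s))
... | no 4∤s  = ∣+⇒∣dist x x′ x0 (proj₂ (root-mod-2^[1+j] 2∤x 2∤x0 j x-root) 4∤s)
                                  (proj₂ (root-mod-2^[1+j] 2∤x′ 2∤x0 j x′-root) (4∤s ∘ s′⇒s))

-- Separates the two residues modulo 2h that agree modulo h.
lowerHalf : ℕ → ℕ → Bool
lowerHalf e x = does (2 * (x %₀ e) <? e)

half-determined : ∀ h .{{_ : NonZero h}} {x x′} → h ∣ dist x x′ →
  lowerHalf (2 * h) x ≡ lowerHalf (2 * h) x′ → 2 * h ∣ dist x x′
half-determined h@(suc _) {x} {x′} h∣x-x′ same-half =
  %-≡⇒∣dist (2 * h) {x} {x′} (%-≡∧/-≡⇒≡ h {x % (2 * h)} {x′ % (2 * h)} r%h≡r′%h r/h≡r′/h)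
  where
  r%h≡r′%h : x % (2 * h) % h ≡ x′ % (2 * h) % h
  r%h≡r′%h = trans (m∣n⇒o%n%m≡o%m h (2 * h) x (n∣m*n 2))
    (trans (∣dist⇒%-≡ h {x} {x′} h∣x-x′) (sym (m∣n⇒o%n%m≡o%m h (2 * h) x′ (n∣m*n 2))))
  lower⇒lower : ∀ z z′ → lowerHalf (2 * h) z ≡ lowerHalf (2 * h) z′ → z % (2 * h) < h → z′ % (2 * h) < h
  lower⇒lower z z′ same z<h = *-cancelˡ-< 2 (z′ % (2 * h)) h
    (does-≡⇒ (2 * (z % (2 * h)) <? 2 * h) (2 * (z′ % (2 * h)) <? 2 * h) same (*-monoʳ-< 2 z<h))
  r/h≡r′/h : x % (2 * h) / h ≡ x′ % (2 * h) / h
  r/h≡r′/h with x % (2 * h) <? h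
  ... | yes r<h = trans (m<n⇒m/n≡0 r<h) (sym (m<n⇒m/n≡0 (lower⇒lower x x′ same-half r<h)))
  ... | no r≮h  = trans (h≤m<2h⇒m/h≡1 (≮⇒≥ r≮h) (m%n<n x (2 * h)))
    (sym (h≤m<2h⇒m/h≡1 (≮⇒≥ (λ r′<h → r≮h (lower⇒lower x′ x (sym same-half) r′<h))) (m%n<n x′ (2 * h))))

-- For odd p, whether p ∣ s decides if the p-part of e divides x − x0 or x + x0 (s = |x − x0|);
-- for p = 2 the deciding question is whether 4 ∣ s.
signBit : ℕ → ℕ → Bool
signBit s p with p ≟ 2
... | yes _ = does (4 ∣? s)
... | no  _ = does (p ∣? s)

signBit-odd : ∀ {p} s → p ≢ 2 → signBit s p ≡ does (p ∣? s)
signBit-odd {p} s p≢2 with p ≟ 2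
... | yes p≡2 = ⊥-elim (p≢2 p≡2)
... | no  _   = refl

SameSigns : ℕ → ℕ → ℕ → Set
SameSigns e s s′ = ∀ p → Prime p → p ∣ e → signBit s p ≡ signBit s′ p

SameSigns-sym : ∀ {e s s′} → SameSigns e s s′ → SameSigns e s′ s
SameSigns-sym same p p-prime p∣e = sym (same p p-prime p∣e)

SameSigns⇒odd-primes : ∀ {e o s s′} → SameSigns e s s′ → o ∣ e → ¬ 2 ∣ o →
  ∀ p → Prime p → p ∣ o → p ∣ s → p ∣ s′
SameSigns⇒odd-primes {s = s} {s′} same o∣e 2∤o p p-prime p∣o = does-≡⇒ (p ∣? s) (p ∣? s′)
  (trans (sym (signBit-odd s p≢2)) (trans (same p p-prime (∣-trans p∣o o∣e)) (signBit-odd s′ p≢2)))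
  where
  p≢2 : p ≢ 2
  p≢2 refl = 2∤o p∣o

SameSigns⇒4∣ : ∀ {e s s′} → SameSigns e s s′ → 2 ∣ e → 4 ∣ s → 4 ∣ s′
SameSigns⇒4∣ {s = s} {s′} same 2∣e = does-≡⇒ (4 ∣? s) (4 ∣? s′) (same 2 prime[2] 2∣e)

root-determined : ∀ e .{{_ : NonZero e}} {x x′ x0} → Coprime x e → Coprime x′ e → Coprime x0 e →
  e ∣ dist x x0 * (x + x0) → e ∣ dist x′ x0 * (x′ + x0) →
  SameSigns e (dist x x0) (dist x′ x0) → lowerHalf e x ≡ lowerHalf e x′ → e ∣ dist x x′
root-determined e {x} {x′} {x0} x⊥e x′⊥e x0⊥e x-root x′-root same-signs same-half with 2-adic e
... | k , o , e≡2^k*o , 2∤o = by-2-power k e≡2^k*o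
  where
  o∣e : o ∣ e
  o∣e = divides (2 ^ k) e≡2^k*o
  instance _ = ∣-nonZero o∣e
  o∣x-x′ : o ∣ dist x x′
  o∣x-x′ = odd-root-determined {x = x} {x′} {x0} 2∤o (coprime-∣ʳ x⊥e o∣e) (coprime-∣ʳ x′⊥e o∣e)
    (∣-trans o∣e x-root) (∣-trans o∣e x′-root)
    (SameSigns⇒odd-primes same-signs o∣e 2∤o) (SameSigns⇒odd-primes (SameSigns-sym same-signs) o∣e 2∤o)
  by-2-power : ∀ k → e ≡ 2 ^ k * o → e ∣ dist x x′
  by-2-power zero    e≡o = subst (_∣ dist x x′) (sym (trans e≡o (*-identityˡ o))) o∣x-x′
  by-2-power (suc j) e≡2^[1+j]o = subst (_∣ dist x x′) (sym e≡2h)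
    (half-determined h {x} {x′} h∣x-x′ (subst (λ n → lowerHalf n x ≡ lowerHalf n x′) e≡2h same-half))
    where
    h = 2 ^ j * o
    e≡2h : e ≡ 2 * h
    e≡2h = trans e≡2^[1+j]o (*-assoc 2 (2 ^ j) o)
    2∣e : 2 ∣ e
    2∣e = divides h (trans e≡2h (*-comm 2 h))
    2^[1+j]∣e : 2 ^ suc j ∣ e
    2^[1+j]∣e = divides o (trans e≡2^[1+j]o (*-comm (2 ^ suc j) o))
    instance _ = ∣-nonZero (divides 2 e≡2h)
    2^j∣x-x′ : 2 ^ j ∣ dist x x′
    2^j∣x-x′ = 2-power-root-determined j {x} {x′} {x0}
      (coprime∧∣⇒∤ x⊥e 2∣e) (coprime∧∣⇒∤ x′⊥e 2∣e) (coprime∧∣⇒∤ x0⊥e 2∣e)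
      (∣-trans 2^[1+j]∣e x-root) (∣-trans 2^[1+j]∣e x′-root)
      (SameSigns⇒4∣ same-signs 2∣e) (SameSigns⇒4∣ (SameSigns-sym same-signs) 2∣e)
    h∣x-x′ : h ∣ dist x x′
    h∣x-x′ = coprime⇒*∣ (coprime-^ˡ (prime∤⇒coprime prime[2] 2∤o) j) 2^j∣x-x′ o∣x-x′

-- The encoding of counted pairs

Code : Set
Code = ℕ × List Bool × Bool × ℕ

module _ (q : ℕ) where

  divisors : List ℕ
  divisors = filter (λ d → d ∣? q) (range1 q)

  primeDivisors : List ℕ
  primeDivisors = filter (λ p → prime? p ×-dec p ∣? q) (range1 q)

  signature : ℕ → List Bool
  signature s = map (signBit s) primeDivisors

  ∈-primeDivisors : ∀ {p} .{{_ : NonZero q}} → Prime p → p ∣ q → p ∈ primeDivisors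
  ∈-primeDivisors p-prime p∣q =
    ∈-filter⁺ (λ p → prime? p ×-dec p ∣? q) (∈-range1⁺ {{prime⇒nonZero p-prime}} (∣⇒≤ p∣q)) (p-prime , p∣q)

  codes : List Code
  codes = cartesianProduct divisors
            (cartesianProduct (bitStrings (ω q)) (cartesianProduct (true ∷ false ∷ []) (upTo q)))

  length-codes : length codes ≡ 2 ^ (ω q + 1) * τ q * q
  length-codes = begin
    length codes
      ≡⟨ length-cartesianProduct divisors _ ⟩
    τ q * length (cartesianProduct (bitStrings (ω q)) (cartesianProduct (true ∷ false ∷ []) (upTo q)))
      ≡⟨ cong (τ q *_) (length-cartesianProduct (bitStrings (ω q)) _) ⟩
    τ q * (length (bitStrings (ω q)) * length (cartesianProduct (true ∷ false ∷ []) (upTo q)))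
      ≡⟨ cong (λ n → τ q * (length (bitStrings (ω q)) * n))
              (length-cartesianProduct (true ∷ false ∷ []) (upTo q)) ⟩
    τ q * (length (bitStrings (ω q)) * (2 * length (upTo q)))
      ≡⟨ cong₂ (λ n l → τ q * (n * (2 * l))) (length-bitStrings (ω q)) (length-upTo q) ⟩
    τ q * (2 ^ ω q * (2 * q))
      ≡⟨ rearrange (τ q) (2 ^ ω q) q ⟩
    2 ^ ω q * 2 ^ 1 * τ q * q
      ≡⟨ cong (λ n → n * τ q * q) (^-distribˡ-+-* 2 (ω q) 1) ⟨
    2 ^ (ω q + 1) * τ q * q
      ∎
    where
    open ≡-Reasoning
    rearrange : ∀ t n q → t * (n * (2 * q)) ≡ n * (2 * 1) * t * q
    rearrange = ℕ.solve-∀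

module _ (q : ℕ) .{{_ : NonZero q}} (a b : ℤ) where

  Counted : ℕ × ℕ → Set
  Counted xy = Coprime (proj₁ xy * proj₂ xy) q × g q a b (proj₁ xy) ≡ g q a b (proj₂ xy)

  counted? : ∀ xy → Dec (Counted xy)
  counted? xy = coprime? (proj₁ xy * proj₂ xy) q ×-dec (g q a b (proj₁ xy) ≟ g q a b (proj₂ xy))

  pairs : List (ℕ × ℕ)
  pairs = filter counted? (cartesianProduct (range1 q) (range1 q))

  cofactor gcdCofactor lcmCofactor : ℕ → ℕ
  cofactor d = q /₀ d
  gcdCofactor d = gcd d (cofactor d)
  lcmCofactor d = lcm d (cofactor d)

  form : ℕ → ℕ → ℤ
  form x y = b ℤ.* + x ℤ.* + y ℤ.- a

  IsRoot : ℕ → ℕ → Set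
  IsRoot e z = Coprime z q × e ∣ ∣ form z z ∣

  isRoot? : ∀ e z → Dec (IsRoot e z)
  isRoot? e z = coprime? z q ×-dec (e ∣? ∣ form z z ∣)

  root₀ : ℕ → ℕ
  root₀ d = first (isRoot? (gcdCofactor d)) (range1 q)

  -- Packs (x − 1) div e < ℓ and (y − 1) div ℓ < e into a single number below eℓ = q.
  index : ℕ → ℕ → ℕ → ℕ
  index d x y = (x ∸ 1) /₀ gcdCofactor d * gcdCofactor d + (y ∸ 1) /₀ lcmCofactor d

  divisorOf : ℕ → ℕ → ℕ
  divisorOf x y = gcd (dist x y) q

  codeAt : ℕ → ℕ → ℕ → List Bool × Bool × ℕ
  codeAt d x y = signature q (dist x (root₀ d)) , lowerHalf (gcdCofactor d) x , index d x y

  code : ℕ × ℕ → Code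
  code (x , y) = divisorOf x y , codeAt (divisorOf x y) x y

  record Admissible (d x y : ℕ) : Set where
    field
      x∈ : x ∈ range1 q
      y∈ : y ∈ range1 q
      x⊥q : Coprime x q
      d∣x-y : d ∣ dist x y
      cofactor∣form : cofactor d ∣ ∣ form x y ∣

  module Divisor (d : ℕ) .{{_ : NonZero d}} (d∣q : d ∣ q) where

    m e ℓ x0 : ℕ
    m = cofactor d
    e = gcdCofactor d
    ℓ = lcmCofactor d
    x0 = root₀ d

    d*m≡q : d * m ≡ q
    d*m≡q = trans (cong (d *_) (/₀≡/ q d)) (m*[n/m]≡n d∣q)

    e*ℓ≡q : e * ℓ ≡ q
    e*ℓ≡q = trans (gcd*lcm d m) d*m≡q

    m∣q : m ∣ q
    m∣q = divides d (sym d*m≡q)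

    e∣q : e ∣ q
    e∣q = ∣-trans (gcd[m,n]∣n d m) m∣q

    instance
      _ = ∣-nonZero m∣q
      _ = ∣-nonZero e∣q
      _ = ∣-nonZero {ℓ} (divides e (sym e*ℓ≡q))

    module _ {x y} (adm : Admissible d x y) where
      open Admissible adm

      x-isRoot : IsRoot e x
      x-isRoot = x⊥q , ℤ.∣⇒∣ᵤ (subst (+ e ℤ.∣_) (expand a b (+ x) (+ y))
        (ℤ.∣m∣n⇒∣m+n (ℤ.∣ᵤ⇒∣ {i = form x y} (∣-trans (gcd[m,n]∣n d m) cofactor∣form))
                     (ℤ.∣n⇒∣m*n (b ℤ.* + x)
                       (ℤ.∣ᵤ⇒∣ {i = + x ℤ.- + y} (∣-trans (gcd[m,n]∣m d m) d∣x-y)))))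
        where
        expand : ∀ a b x y → (b ℤ.* x ℤ.* y ℤ.- a) ℤ.+ b ℤ.* x ℤ.* (x ℤ.- y) ≡ b ℤ.* x ℤ.* x ℤ.- a
        expand = solve-∀

      x0-isRoot : IsRoot e x0
      x0-isRoot = first-satisfies (isRoot? e) (range1 q) x∈ x-isRoot

      e∣dist*sum : Coprime ∣ b ∣ q → e ∣ dist x x0 * (x + x0)
      e∣dist*sum b⊥q = coprime-divisor (Coprime.sym (coprime-∣ʳ b⊥q e∣q))
        (subst (e ∣_) (trans (ℤ.abs-* b _) (cong (∣ b ∣ *_) (ℤ.abs-* (+ x ℤ.- + x0) (+ x ℤ.+ + x0))))
          (ℤ.∣⇒∣ᵤ (subst (+ e ℤ.∣_) (factor a b (+ x) (+ x0))
            (ℤ.∣m∣n⇒∣m-n (ℤ.∣ᵤ⇒∣ {i = form x x} (proj₂ x-isRoot))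
                         (ℤ.∣ᵤ⇒∣ {i = form x0 x0} (proj₂ x0-isRoot))))))
        where
        factor : ∀ a b x x0 →
          (b ℤ.* x ℤ.* x ℤ.- a) ℤ.- (b ℤ.* x0 ℤ.* x0 ℤ.- a) ≡ b ℤ.* ((x ℤ.- x0) ℤ.* (x ℤ.+ x0))
        factor = solve-∀

    x-quotient<ℓ : ∀ {x} → x ∈ range1 q → (x ∸ 1) /₀ e < ℓ
    x-quotient<ℓ {x} x∈ = /₀-<-range1 (subst (λ n → x ∈ range1 n) (sym (trans (*-comm ℓ e) e*ℓ≡q)) x∈)

    y-quotient<e : ∀ {y} → y ∈ range1 q → (y ∸ 1) /₀ ℓ < e
    y-quotient<e {y} y∈ = /₀-<-range1 (subst (λ n → y ∈ range1 n) (sym e*ℓ≡q) y∈)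

    index<q : ∀ {x y} → x ∈ range1 q → y ∈ range1 q → index d x y < q
    index<q {x} {y} x∈ y∈ =
      subst (index d x y <_) (trans (*-comm ℓ e) e*ℓ≡q) (j*n+k<m*n (x-quotient<ℓ x∈) (y-quotient<e y∈))

    x-determined : Coprime ∣ b ∣ q → ∀ {x y x′ y′} → Admissible d x y → Admissible d x′ y′ →
      SameSigns e (dist x x0) (dist x′ x0) → lowerHalf e x ≡ lowerHalf e x′ →
      (x ∸ 1) /₀ e ≡ (x′ ∸ 1) /₀ e → x ≡ x′
    x-determined b⊥q {x} {y} {x′} {y′} adm adm′ same-signs same-half same-quotient =
      ∣dist∧/₀-≡⇒≡ e (x∈ adm) (x∈ adm′) e∣x-x′ same-quotient
      where
      open Admissible
      e∣x-x′ : e ∣ dist x x′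
      e∣x-x′ = root-determined e {x} {x′} {x0}
        (coprime-∣ʳ (x⊥q adm) e∣q) (coprime-∣ʳ (x⊥q adm′) e∣q) (coprime-∣ʳ (proj₁ (x0-isRoot adm)) e∣q)
        (e∣dist*sum adm b⊥q) (e∣dist*sum adm′ b⊥q) same-signs same-half

    y-determined : Coprime ∣ b ∣ q → ∀ {x y y′} → Admissible d x y → Admissible d x y′ →
      (y ∸ 1) /₀ ℓ ≡ (y′ ∸ 1) /₀ ℓ → y ≡ y′
    y-determined b⊥q {x} {y} {y′} adm adm′ same-quotient =
      ∣dist∧/₀-≡⇒≡ ℓ (y∈ adm) (y∈ adm′) (lcm-least d∣y-y′ m∣y-y′) same-quotient
      where
      open Admissible
      d∣y-y′ : d ∣ dist y y′
      d∣y-y′ = ∣dist-trans y y′ x (subst (d ∣_) (dist-comm x y) (d∣x-y adm))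
                                  (subst (d ∣_) (dist-comm x y′) (d∣x-y adm′))
      m∣y-y′ : m ∣ dist y y′
      m∣y-y′ = coprime-divisor (Coprime.sym (coprime-*ˡ (coprime-∣ʳ b⊥q m∣q) (coprime-∣ʳ (x⊥q adm) m∣q)))
        (subst (m ∣_) (trans (ℤ.abs-* (b ℤ.* + x) _) (cong (_* dist y y′) (ℤ.abs-* b (+ x))))
          (ℤ.∣⇒∣ᵤ (subst (+ m ℤ.∣_) (factor a b (+ x) (+ y) (+ y′))
            (ℤ.∣m∣n⇒∣m-n (ℤ.∣ᵤ⇒∣ {i = form x y} (cofactor∣form adm))
                         (ℤ.∣ᵤ⇒∣ {i = form x y′} (cofactor∣form adm′))))))
        where
        factor : ∀ a b x y y′ →
          (b ℤ.* x ℤ.* y ℤ.- a) ℤ.- (b ℤ.* x ℤ.* y′ ℤ.- a) ≡ (b ℤ.* x) ℤ.* (y ℤ.- y′)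
        factor = solve-∀

    codeAt-injective : Coprime ∣ b ∣ q → ∀ {x y x′ y′} → Admissible d x y → Admissible d x′ y′ →
      codeAt d x y ≡ codeAt d x′ y′ → x ≡ x′ × y ≡ y′
    codeAt-injective b⊥q {x} {y} {x′} {y′} adm adm′ same-code = x≡x′ , y≡y′
      where
      same-quotients = *+-injective e (y-quotient<e (Admissible.y∈ adm)) (y-quotient<e (Admissible.y∈ adm′))
        (cong (proj₂ ∘ proj₂) same-code)
      same-signs : SameSigns e (dist x x0) (dist x′ x0)
      same-signs p p-prime p∣e = map-≡⇒≡ (signBit (dist x x0)) (signBit (dist x′ x0)) (cong proj₁ same-code)
        (∈-primeDivisors q p-prime (∣-trans p∣e e∣q))
      x≡x′ : x ≡ x′
      x≡x′ = x-determined b⊥q adm adm′ same-signs (cong (proj₁ ∘ proj₂) same-code) (proj₁ same-quotients)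
      y≡y′ : y ≡ y′
      y≡y′ = y-determined b⊥q adm (subst (λ z → Admissible d z y′) (sym x≡x′) adm′) (proj₂ same-quotients)

  module _ {x y} (xy∈ : (x , y) ∈ pairs) where

    private
      d = divisorOf x y
      membership = ∈-filter⁻ counted? {xs = cartesianProduct (range1 q) (range1 q)} xy∈
      xy⊥q = proj₁ (proj₂ membership)
      x⊥q : Coprime x q
      x⊥q (i∣x , i∣q) = xy⊥q (∣m⇒∣m*n y i∣x , i∣q)
      y⊥q : Coprime y q
      y⊥q (i∣y , i∣q) = xy⊥q (∣n⇒∣m*n x i∣y , i∣q)

    divisorOf∣q : d ∣ q
    divisorOf∣q = gcd[m,n]∣n (dist x y) q

    instance
      divisorOf-nonZero : NonZero d
      divisorOf-nonZero = gcd-nonZeroʳ (dist x y) q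

    pair⇒admissible : Admissible d x y
    pair⇒admissible = record
      { x∈ = proj₁ (∈-cartesianProduct⁻ (range1 q) (range1 q) (proj₁ membership))
      ; y∈ = proj₂ (∈-cartesianProduct⁻ (range1 q) (range1 q) (proj₁ membership))
      ; x⊥q = x⊥q
      ; d∣x-y = gcd[m,n]∣m (dist x y) q
      ; cofactor∣form = subst (_∣ ∣ form x y ∣) (sym (/₀≡/ q d))
          (n∣m*o⇒n/gcd[m,n]∣o (dist x y)
            (subst (q ∣_) (ℤ.abs-* (+ x ℤ.- + y) (form x y))
              (ℤ.∣⇒∣ᵤ (g-≡⇒∣ q a b x⊥q y⊥q (proj₂ (proj₂ membership))))))
      }

  code-injective : Coprime ∣ b ∣ q →
    ∀ {xy xy′} → xy ∈ pairs → xy′ ∈ pairs → code xy ≡ code xy′ → xy ≡ xy′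
  code-injective b⊥q {x , y} {x′ , y′} xy∈ xy′∈ same-code =
    cong₂ _,_ (proj₁ same-pair) (proj₂ same-pair)
    where
    d = divisorOf x y
    d≡d′ : d ≡ divisorOf x′ y′
    d≡d′ = cong proj₁ same-code
    same-codeAt : codeAt d x y ≡ codeAt d x′ y′
    same-codeAt = subst (λ d′ → codeAt d x y ≡ codeAt d′ x′ y′) (sym d≡d′) (cong proj₂ same-code)
    open Divisor d {{divisorOf-nonZero xy∈}} (divisorOf∣q xy∈)
    same-pair = codeAt-injective b⊥q (pair⇒admissible xy∈)
      (subst (λ d′ → Admissible d′ x′ y′) (sym d≡d′) (pair⇒admissible xy′∈)) same-codeAt

  code∈codes : ∀ {xy} → xy ∈ pairs → code xy ∈ codes q
  code∈codes {x , y} xy∈ =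
    ∈-cartesianProduct⁺ d∈ (∈-cartesianProduct⁺ signature∈ (∈-cartesianProduct⁺ half∈ index∈))
    where
    d = divisorOf x y
    instance _ = divisorOf-nonZero xy∈
    d∈ : d ∈ divisors q
    d∈ = ∈-filter⁺ (λ d → d ∣? q) (∈-range1⁺ (∣⇒≤ (divisorOf∣q xy∈))) (divisorOf∣q xy∈)
    signature∈ : signature q (dist x (root₀ d)) ∈ bitStrings (ω q)
    signature∈ = subst (λ n → signature q (dist x (root₀ d)) ∈ bitStrings n)
      (length-map (signBit (dist x (root₀ d))) (primeDivisors q)) (∈-bitStrings _)
    half∈ : lowerHalf (gcdCofactor d) x ∈ true ∷ false ∷ []
    half∈ with lowerHalf (gcdCofactor d) x
    ... | true  = here refl
    ... | false = there (here refl)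
    index∈ : index d x y ∈ upTo q
    index∈ = ∈-upTo⁺ (Divisor.index<q d (divisorOf∣q xy∈) (Admissible.x∈ adm) (Admissible.y∈ adm))
      where adm = pair⇒admissible xy∈

  pairs-unique : Unique pairs
  pairs-unique = Unique.filter⁺ counted?
    (Unique.cartesianProduct⁺ range1-unique range1-unique)
    where
    range1-unique : Unique (range1 q)
    range1-unique = Unique.map⁺ suc-injective (Unique.upTo⁺ q)

lemma2 : (q : ℕ) → .{{_ : NonZero q}} → 2 ≤ q → (a b : ℤ) → Coprime ∣ a ℤ.* b ∣ q →
    κ q a b ≤ 2 ^ (ω q + 1) * τ q * q
lemma2 q _ a b ab⊥q = begin
  κ q a b                  ≤⟨ length-≤-injection (code q a b) (pairs q a b) (codes q)
                                (pairs-unique q a b) (code-injective q a b b⊥q) (code∈codes q a b) ⟩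
  length (codes q)         ≡⟨ length-codes q ⟩
  2 ^ (ω q + 1) * τ q * q  ∎
  where
  open ≤-Reasoning
  b⊥q : Coprime ∣ b ∣ q
  b⊥q = Coprime.sym (coprime-∣ʳ (Coprime.sym ab⊥q) (subst (∣ b ∣ ∣_) (sym (ℤ.abs-* a b)) (n∣m*n ∣ a ∣)))
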